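{- Let $D$ be an oriented graph on $n$ vertices with strong diameter $2$. Then $\pi(D)\leq n+1$.
   Context: An oriented graph is a loopless directed graph with no pair of opposite arcs (never both $i\to j$ and $j\to i$). $D$ has strong diameter $2$ if for every ordered pair of distinct vertices $(i,j)$ there is a directed path from $i$ to $j$ of length at most $2$. A configuration is a function $C:V(D)\to\mathbb{N}$ (number of pebbles on each vertex); its size is $|C|=\sum_v C(v)$. A pebbling move along an arc $i\to j$ removes two pebbles from $i$ and adds one pebble to $j$. Given a root $r$, a configuration is $r$-solvable if some sequence (possibly empty) of pebbling moves places at least one pebble on $r$. The pebbling number $\pi(D)$ is the minimum $t$ such that every configuration of size $t$ is $r$-solvable for every choice of root $r\in V(D)$. -}

module Defs where

open import Data.Nat using (ℕ; zero; suc; _+_; _∸_; _≤_; _≥_)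
open import Data.Nat.ListAction using (sum)
open import Data.Sum using (_⊎_)
open import Data.Fin using (Fin; _≟_)
open import Data.List using (tabulate)
open import Data.Product using (Σ; _×_; ∃; ∃-syntax)
open import Relation.Binary.PropositionalEquality using (_≡_; _≢_)
open import Relation.Nullary using (¬_; yes; no)

Digraph : ℕ → Set₁
Digraph n = Fin n → Fin n → Set

IsOriented : ∀ {n} → Digraph n → Set
IsOriented {n} A = (∀ i → ¬ A i i) × (∀ i j → A i j → ¬ A j i)

PathLe2 : ∀ {n} → Digraph n → Fin n → Fin n → Set
PathLe2 {n} A i j = A i j ⊎ (∃[ k ] (A i k × A k j))

HasStrongDiam2 : ∀ {n} → Digraph n → Set
HasStrongDiam2 {n} A = ∀ i j → i ≢ j → PathLe2 A i j

Config : ℕ → Set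
Config n = Fin n → ℕ

size : ∀ {n} → Config n → ℕ
size {n} C = sum (tabulate C)

-- Result of a pebbling move along arc i → j: remove two pebbles from i
-- (requires C i ≥ 2, enforced in Move) and add one to j.
moveConfig : ∀ {n} → Fin n → Fin n → Config n → Config n
moveConfig i j C v with v ≟ i | v ≟ j
... | yes _ | _     = C v ∸ 2
... | no _  | yes _ = suc (C v)
... | no _  | no _  = C v

data Move {n} (A : Digraph n) : Config n → Config n → Set where
  move : ∀ {C} i j → A i j → 2 ≤ C i → Move A C (moveConfig i j C)

data Reach {n} (A : Digraph n) : Config n → Config n → Set where
  done : ∀ {C} → Reach A C C
  step : ∀ {C C' C''} → Move A C C' → Reach A C' C'' → Reach A C C''

Solvable : ∀ {n} → Digraph n → Config n → Fin n → Set
Solvable A C r = ∃[ C' ] (Reach A C C' × 1 ≤ C' r)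

PebblingProperty : ∀ {n} → Digraph n → ℕ → Set
PebblingProperty {n} A t = ∀ (C : Config n) → size C ≡ t → ∀ (r : Fin n) → Solvable A C r

-- π(D) ≤ m  (π(D) = least t with PebblingProperty) iff some t ≤ m has the property.
PebblingNumber≤ : ∀ {n} → Digraph n → ℕ → Set
PebblingNumber≤ A m = ∃[ t ] (t ≤ m × PebblingProperty A t)

-- Fix a root r and a configuration C from which r cannot be reached; we show |C| ≤ n. Call a
-- vertex heavy if it carries at least two pebbles. Unsolvability forces C r = 0, at most three
-- pebbles everywhere and at most one on each in-neighbour of r, so every heavy u has a hub
-- u → hub u → r; the hub is empty and no other heavy vertex has an arc into it. Thus every heavy
-- vertex owns an empty vertex, and a vertex with three pebbles owns a second one, with at most
-- one exception: if neither x nor y (both with three pebbles) has a second private empty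
-- out-neighbour, the short path from x to hub y yields an empty vertex whose only heavy
-- in-neighbours are x and y, or an arc hub x → hub y, and the arcs hub x → hub y and
-- hub y → hub x cannot both exist in an oriented graph. Hence
-- C v ≤ [C v > 0] + #(vertices owned by v) + [v is the exception], while the owned vertices are
-- distinct, empty and different from r, so |C| ≤ #occupied + (#empty − 1) + 1 = n.
module Submission where

open import Defs
open import Data.Nat using (ℕ; zero; suc; _+_; _∸_; _≤_; _<_; z≤n; s≤s; s≤s⁻¹; _≤?_)
open import Data.Nat.Properties hiding (_≟_)
open import Data.Fin using (Fin; zero; suc; _≟_)
open import Data.Fin.Properties using (any?; all?)
open import Data.List using (List; []; _∷_)
open import Data.List.Membership.Propositional using (_∈_)
open import Data.List.Relation.Unary.Any using (here; there)
open import Data.Product using (Σ; _×_; ∃; ∃₂; ∃-syntax; _,_; proj₁; proj₂)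
open import Data.Product.Properties using (≡-dec)
open import Data.Empty using (⊥-elim)
open import Data.Sum using (_⊎_; inj₁; inj₂)
import Data.Sum as Sum
open import Relation.Binary.PropositionalEquality
open import Relation.Nullary using (¬_; Dec; yes; no; does)
open import Relation.Nullary.Decidable using (map′; decidable-stable; ¬?; _×-dec_; _⊎-dec_; _→-dec_)
open import Function using (_∘_; id)
open import Data.Bool using (if_then_else_)
open import Relation.Unary using (Pred; Decidable)
open import Algebra.Properties.CommutativeMonoid.Sum +-0-commutativeMonoid
  using (sum; sum-cong-≗; sum-replicate-zero; ∑-distrib-+; ∑-comm)
import Data.Nat as ℕ

size≡sum : ∀ {n} (C : Config n) → size C ≡ sum C
size≡sum {zero} C = refl
size≡sum {suc n} C = cong (C zero +_) (size≡sum (λ v → C (suc v)))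

sum-mono-≤ : ∀ {n} {f g : Fin n → ℕ} → (∀ v → f v ≤ g v) → sum f ≤ sum g
sum-mono-≤ {zero} f≤g = z≤n
sum-mono-≤ {suc n} f≤g = +-mono-≤ (f≤g _) (sum-mono-≤ (λ v → f≤g (suc v)))

sum-ones : ∀ n → sum {n} (λ _ → 1) ≡ n
sum-ones zero = refl
sum-ones (suc n) = cong suc (sum-ones n)

-- Defined through `does`, so that 𝟙 (suc v ≟ suc a) computes to 𝟙 (v ≟ a).
𝟙 : ∀ {p} {P : Set p} → Dec P → ℕ
𝟙 P? = if does P? then 1 else 0

𝟙-mono : ∀ {p q} {P : Set p} {Q : Set q} (P? : Dec P) (Q? : Dec Q) → (P → Q) → 𝟙 P? ≤ 𝟙 Q?
𝟙-mono (yes _) (yes _) _   = ≤-refl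
𝟙-mono (yes p) (no ¬q) p⇒q = ⊥-elim (¬q (p⇒q p))
𝟙-mono (no _)  _       _   = z≤n

count : ∀ {n p} {P : Pred (Fin n) p} → Decidable P → ℕ
count P? = sum (λ v → 𝟙 (P? v))

count-≡ : ∀ {n} (a : Fin n) → count (_≟ a) ≡ 1
count-≡ {suc n} zero    = cong suc (sum-replicate-zero n)
count-≡ {suc n} (suc a) = count-≡ a

count-mono : ∀ {n p q} {P : Pred (Fin n) p} {Q : Pred (Fin n) q} (P? : Decidable P) (Q? : Decidable Q) →
             (∀ v → P v → Q v) → count P? ≤ count Q?
count-mono P? Q? P⊆Q = sum-mono-≤ (λ v → 𝟙-mono (P? v) (Q? v) (P⊆Q v))

count-none : ∀ {n p} {P : Pred (Fin n) p} (P? : Decidable P) → (∀ v → ¬ P v) → count P? ≡ 0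
count-none {n} P? none = n≤0⇒n≡0 (begin
  count P?                  ≤⟨ sum-mono-≤ (λ v → 𝟙-mono (P? v) (no λ ()) (none v)) ⟩
  sum {n} (λ _ → 0)         ≡⟨ sum-replicate-zero n ⟩
  0                         ∎)
  where open ≤-Reasoning

count-≤1 : ∀ {n p} {P : Pred (Fin n) p} (P? : Decidable P) → (∀ v w → P v → P w → v ≡ w) → count P? ≤ 1
count-≤1 P? unique with any? P?
... | yes (a , Pa) = ≤-trans (count-mono P? (_≟ a) (λ v Pv → unique v a Pv Pa)) (≤-reflexive (count-≡ a))
... | no ∄P        = ≤-trans (≤-reflexive (count-none P? (λ v Pv → ∄P (v , Pv)))) z≤n

count-≥1 : ∀ {n p} {P : Pred (Fin n) p} (P? : Decidable P) {a} → P a → 1 ≤ count P?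
count-≥1 P? {a} Pa = ≤-trans (≤-reflexive (sym (count-≡ a))) (count-mono (_≟ a) P? (λ { v refl → Pa }))

count-≥2 : ∀ {n p} {P : Pred (Fin n) p} (P? : Decidable P) {a b} → a ≢ b → P a → P b → 2 ≤ count P?
count-≥2 P? {a} {b} a≢b Pa Pb = begin
  2                                          ≡⟨ cong₂ _+_ (count-≡ a) (count-≡ b) ⟨
  count (_≟ a) + count (_≟ b)                ≡⟨ ∑-distrib-+ (λ v → 𝟙 (v ≟ a)) _ ⟨
  sum (λ v → 𝟙 (v ≟ a) + 𝟙 (v ≟ b))          ≤⟨ sum-mono-≤ indicators-disjoint ⟩
  count P?                                   ∎
  where
  open ≤-Reasoning
  indicators-disjoint : ∀ v → 𝟙 (v ≟ a) + 𝟙 (v ≟ b) ≤ 𝟙 (P? v)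
  indicators-disjoint v with v ≟ a | v ≟ b | P? v
  ... | yes refl | yes refl | _      = ⊥-elim (a≢b refl)
  ... | yes refl | no _     | yes _  = ≤-refl
  ... | no _     | yes refl | yes _  = ≤-refl
  ... | no _     | no _     | _      = z≤n
  ... | yes refl | _        | no ¬Pv = ⊥-elim (¬Pv Pa)
  ... | no _     | yes refl | no ¬Pv = ⊥-elim (¬Pv Pb)

module _ {n} {i j : Fin n} {C : Config n} where

  moveConfig-source : moveConfig i j C i ≡ C i ∸ 2
  moveConfig-source with i ≟ i
  ... | yes _  = refl
  ... | no i≢i = ⊥-elim (i≢i refl)

  moveConfig-target : i ≢ j → moveConfig i j C j ≡ suc (C j)
  moveConfig-target i≢j with j ≟ i | j ≟ j
  ... | yes j≡i | _      = ⊥-elim (i≢j (sym j≡i))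
  ... | no _    | yes _  = refl
  ... | no _    | no j≢j = ⊥-elim (j≢j refl)

  moveConfig-other : ∀ {v} → v ≢ i → C v ≤ moveConfig i j C v
  moveConfig-other {v} v≢i with v ≟ i | v ≟ j
  ... | yes v≡i | _     = ⊥-elim (v≢i v≡i)
  ... | no _    | yes _ = n≤1+n (C v)
  ... | no _    | no _  = ≤-refl

  size-moveConfig : i ≢ j → 2 ≤ C i → suc (size (moveConfig i j C)) ≡ size C
  size-moveConfig i≢j 2≤Ci = +-cancelʳ-≡ 1 _ _ (begin
    suc (size C′) + 1                              ≡⟨ cong (_+ 1) (+-comm 1 (size C′)) ⟩
    size C′ + 1 + 1                                ≡⟨ cong (λ s → s + 1 + 1) (size≡sum C′) ⟩
    sum C′ + 1 + 1                                 ≡⟨ cong (λ k → sum C′ + k + k) (count-≡ i) ⟨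
    sum C′ + count (_≟ i) + count (_≟ i)           ≡⟨ cong (_+ count (_≟ i)) (∑-distrib-+ C′ _) ⟨
    sum (λ v → C′ v + 𝟙 (v ≟ i)) + count (_≟ i)    ≡⟨ ∑-distrib-+ (λ v → C′ v + 𝟙 (v ≟ i)) _ ⟨
    sum (λ v → C′ v + 𝟙 (v ≟ i) + 𝟙 (v ≟ i))       ≡⟨ sum-cong-≗ pointwise ⟩
    sum (λ v → C v + 𝟙 (v ≟ j))                    ≡⟨ ∑-distrib-+ C _ ⟩
    sum C + count (_≟ j)                           ≡⟨ cong₂ _+_ (sym (size≡sum C)) (count-≡ j) ⟩
    size C + 1                                     ∎)
    where
    open ≡-Reasoning
    C′ : Config n
    C′ = moveConfig i j C
    pointwise : ∀ v → C′ v + 𝟙 (v ≟ i) + 𝟙 (v ≟ i) ≡ C v + 𝟙 (v ≟ j)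
    pointwise v with v ≟ i | v ≟ j
    ... | yes refl | yes refl = ⊥-elim (i≢j refl)
    ... | yes refl | no _     = trans (+-assoc (C v ∸ 2) 1 1) (trans (m∸n+n≡m 2≤Ci) (sym (+-identityʳ (C v))))
    ... | no _     | yes _    = trans (+-identityʳ _) (trans (+-identityʳ _) (+-comm 1 (C v)))
    ... | no _     | no _     = cong (_+ 0) (+-identityʳ (C v))

module Solvability {n} (G : Digraph n) (loopless : ∀ i → ¬ G i i) (r : Fin n) where

  arc⇒≢ : ∀ {i j} → G i j → i ≢ j
  arc⇒≢ {i} Gii refl = loopless i Gii

  solvable-root : ∀ {C} → 1 ≤ C r → Solvable G C r
  solvable-root {C} 1≤Cr = C , done , 1≤Cr

  solvable-move : ∀ {C} i j → G i j → 2 ≤ C i → Solvable G (moveConfig i j C) r → Solvable G C r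
  solvable-move i j Gij 2≤Ci (C″ , moves , 1≤C″r) = C″ , step (move i j Gij 2≤Ci) moves , 1≤C″r

  solvable-within : (∀ i j → Dec (G i j)) → ∀ m C → size C ≤ m → Dec (Solvable G C r)
  solvable-within G? m C size≤m with 1 ≤? C r
  ... | yes 1≤Cr = yes (solvable-root 1≤Cr)
  solvable-within G? zero C size≤0 | no r-empty = no λ where
    (_ , done , 1≤Cr) → r-empty 1≤Cr
    (_ , step (move i j Gij 2≤Ci) _ , _) →
      1+n≢0 (n≤0⇒n≡0 (≤-trans (≤-reflexive (size-moveConfig (arc⇒≢ Gij) 2≤Ci)) size≤0))
  solvable-within G? (suc m) C size≤1+m | no r-empty with any? (λ i → any? (λ j → first-move? i j))
    where
    first-move? : ∀ i j → Dec (Σ (G i j) λ _ → Σ (2 ≤ C i) λ _ → Solvable G (moveConfig i j C) r)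
    first-move? i j with G? i j | 2 ≤? C i
    ... | no ¬Gij | _       = no (¬Gij ∘ proj₁)
    ... | yes _   | no 2≰Ci = no (2≰Ci ∘ proj₁ ∘ proj₂)
    ... | yes Gij | yes 2≤Ci = map′ (λ sol → Gij , 2≤Ci , sol) (proj₂ ∘ proj₂)
      (solvable-within G? m (moveConfig i j C)
        (s≤s⁻¹ (≤-trans (≤-reflexive (size-moveConfig (arc⇒≢ Gij) 2≤Ci)) size≤1+m)))
  ... | yes (i , j , Gij , 2≤Ci , sol) = yes (solvable-move i j Gij 2≤Ci sol)
  ... | no ∄move = no λ where
    (_ , done , 1≤Cr) → r-empty 1≤Cr
    (C″ , step (move i j Gij 2≤Ci) moves , 1≤C″r) → ∄move (i , j , Gij , 2≤Ci , C″ , moves , 1≤C″r)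

  solvable? : (∀ i j → Dec (G i j)) → ∀ C → Dec (Solvable G C r)
  solvable? G? C = solvable-within G? (size C) C ≤-refl

-- In the names below the numbers are lower bounds on the pebbles along a path towards r, and
-- `a+b` stands for two vertices with a common out-neighbour.
module Strategies {n} (G : Digraph n) (loopless : ∀ i → ¬ G i i) (diam : HasStrongDiam2 G) (r : Fin n) where
  open Solvability G loopless r

  private
    gains : ∀ (C : Config n) {i j} → G i j → ∀ {k} → k ≤ C j → suc k ≤ moveConfig i j C j
    gains C Gij k≤Cj = ≤-trans (s≤s k≤Cj) (≤-reflexive (sym (moveConfig-target {C = C} (arc⇒≢ Gij))))

    keeps : ∀ (C : Config n) {i} j {v} → v ≢ i → ∀ {k} → k ≤ C v → k ≤ moveConfig i j C v
    keeps C j v≢i k≤Cv = ≤-trans k≤Cv (moveConfig-other {j = j} {C = C} v≢i)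

  solvable-2→r : ∀ {C x} → G x r → 2 ≤ C x → Solvable G C r
  solvable-2→r {C} {x} Gxr 2≤Cx = solvable-move x r Gxr 2≤Cx (solvable-root (gains C Gxr z≤n))

  solvable-4 : ∀ {C v} → 4 ≤ C v → Solvable G C r
  solvable-4 {C} {v} 4≤Cv with v ≟ r
  ... | yes refl = solvable-root (≤-trans (s≤s z≤n) 4≤Cv)
  ... | no v≢r with diam v r v≢r
  ...   | inj₁ Gvr = solvable-2→r Gvr (≤-trans (s≤s (s≤s z≤n)) 4≤Cv)
  ...   | inj₂ (k , Gvk , Gkr) =
    solvable-move v k Gvk (≤-trans (s≤s (s≤s z≤n)) 4≤Cv)
      (solvable-move v k Gvk (≤-trans (∸-monoˡ-≤ 2 4≤Cv) (≤-reflexive (sym (moveConfig-source {C = C}))))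
        (solvable-2→r Gkr (gains C′ Gvk (gains C Gvk z≤n))))
    where
    C′ : Config n
    C′ = moveConfig v k C

  solvable-2→1 : ∀ {C s x} → G s x → G x r → 2 ≤ C s → 1 ≤ C x → Solvable G C r
  solvable-2→1 {C} {s} {x} Gsx Gxr 2≤Cs 1≤Cx = solvable-move s x Gsx 2≤Cs (solvable-2→r Gxr (gains C Gsx 1≤Cx))

  solvable-2+2 : ∀ {C s s′ x} → G s x → G s′ x → s ≢ s′ → G x r → 2 ≤ C s → 2 ≤ C s′ → Solvable G C r
  solvable-2+2 {C} {s} {x = x} Gsx Gs′x s≢s′ Gxr 2≤Cs 2≤Cs′ =
    solvable-move s x Gsx 2≤Cs (solvable-2→1 Gs′x Gxr (keeps C x (≢-sym s≢s′) 2≤Cs′) (gains C Gsx z≤n))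

  solvable-2→3 : ∀ {C v u} → G v u → 2 ≤ C v → 3 ≤ C u → Solvable G C r
  solvable-2→3 {C} {v} {u} Gvu 2≤Cv 3≤Cu = solvable-move v u Gvu 2≤Cv (solvable-4 {v = u} (gains C Gvu 3≤Cu))

  solvable-2→1+2 : ∀ {C w k x v} → G w k → G k x → G v x → G x r → 2 ≤ C w → 1 ≤ C k → 2 ≤ C v →
                   v ≢ w → v ≢ k → Solvable G C r
  solvable-2→1+2 {C} {w} {k} Gwk Gkx Gvx Gxr 2≤Cw 1≤Ck 2≤Cv v≢w v≢k =
    solvable-move w k Gwk 2≤Cw (solvable-2+2 Gkx Gvx (≢-sym v≢k) Gxr (gains C Gwk 1≤Ck) (keeps C k v≢w 2≤Cv))

  solvable-2+2→0+2 : ∀ {C s s′ k x v} → G s k → G s′ k → G k x → G v x → G x r → s ≢ s′ →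
                     2 ≤ C s → 2 ≤ C s′ → 2 ≤ C v → v ≢ s → v ≢ s′ → v ≢ k → Solvable G C r
  solvable-2+2→0+2 {C} {s} {k = k} Gsk Gs′k Gkx Gvx Gxr s≢s′ 2≤Cs 2≤Cs′ 2≤Cv v≢s v≢s′ v≢k =
    solvable-move s k Gsk 2≤Cs
      (solvable-2→1+2 Gs′k Gkx Gvx Gxr (keeps C k (≢-sym s≢s′) 2≤Cs′) (gains C Gsk z≤n)
        (keeps C k v≢s 2≤Cv) v≢s′ v≢k)

Reach-mono : ∀ {n} {G A : Digraph n} → (∀ {i j} → G i j → A i j) → ∀ {C C′} → Reach G C C′ → Reach A C C′
Reach-mono G⊆A done                            = done
Reach-mono G⊆A (step (move i j Gij 2≤Ci) rest) = step (move i j (G⊆A Gij) 2≤Ci) (Reach-mono G⊆A rest)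

Solvable-mono : ∀ {n} {G A : Digraph n} → (∀ {i j} → G i j → A i j) → ∀ {C r} → Solvable G C r → Solvable A C r
Solvable-mono G⊆A (C′ , moves , 1≤C′r) = C′ , Reach-mono G⊆A moves , 1≤C′r

-- The arc relation of a digraph need not be decidable, but the union of one chosen path of
-- length at most 2 for each ordered pair is a decidable subgraph of the same strong diameter.
module Skeleton {n} (A : Digraph n) (diam : HasStrongDiam2 A) where

  arcsOn : ∀ {a b} → PathLe2 A a b → List (Fin n × Fin n)
  arcsOn {a} {b} (inj₁ _)           = (a , b) ∷ []
  arcsOn {a} {b} (inj₂ (k , _ , _)) = (a , k) ∷ (k , b) ∷ []

  arcsOn-⊆ : ∀ {a b} (p : PathLe2 A a b) {i j} → (i , j) ∈ arcsOn p → A i j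
  arcsOn-⊆ (inj₁ Aab)                (here refl)         = Aab
  arcsOn-⊆ (inj₂ (_ , Aak , _))      (here refl)         = Aak
  arcsOn-⊆ (inj₂ (_ , _ , Akb))      (there (here refl)) = Akb

  chosenArcs : Fin n → Fin n → List (Fin n × Fin n)
  chosenArcs a b with a ≟ b
  ... | yes _  = []
  ... | no a≢b = arcsOn (diam a b a≢b)

  chosenArcs-path : ∀ {a b} → a ≢ b → ∃[ p ] chosenArcs a b ≡ arcsOn p
  chosenArcs-path {a} {b} a≢b with a ≟ b
  ... | yes a≡b = ⊥-elim (a≢b a≡b)
  ... | no a≢b′ = diam a b a≢b′ , refl

  Skel : Digraph n
  Skel i j = ∃₂ λ a b → (i , j) ∈ chosenArcs a b

  Skel? : ∀ i j → Dec (Skel i j)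
  Skel? i j = any? λ a → any? λ b → (i , j) ∈? chosenArcs a b
    where open import Data.List.Membership.DecPropositional (≡-dec _≟_ _≟_) using (_∈?_)

  Skel⊆A : ∀ {i j} → Skel i j → A i j
  Skel⊆A {i} {j} (a , b , ij∈) with a ≟ b
  ... | no a≢b = arcsOn-⊆ (diam a b a≢b) ij∈

  Skel-oriented : IsOriented A → IsOriented Skel
  Skel-oriented (loopless , antisym) =
    (λ i → loopless i ∘ Skel⊆A) , (λ i j Sij Sji → antisym i j (Skel⊆A Sij) (Skel⊆A Sji))

  Skel-diam : HasStrongDiam2 Skel
  Skel-diam a b a≢b with chosenArcs-path a≢b
  ... | inj₁ _ , chosen≡               = inj₁ (a , b , subst ((a , b) ∈_) (sym chosen≡) (here refl))
  ... | inj₂ (k , _ , _) , chosen≡     =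
    inj₂ (k , (a , b , subst ((a , k) ∈_) (sym chosen≡) (here refl))
            , (a , b , subst ((k , b) ∈_) (sym chosen≡) (there (here refl))))


occupied+vacant : ∀ c → 𝟙 (1 ≤? c) + 𝟙 (c ℕ.≟ 0) ≡ 1
occupied+vacant zero    = refl
occupied+vacant (suc c) = refl

≤-occupied+ : ∀ {c o} → c ≤ 3 → (2 ≤ c → 1 ≤ o) → (3 ≤ c → 2 ≤ o) → c ≤ 𝟙 (1 ≤? c) + o
≤-occupied+ {0}                   _ _     _     = z≤n
≤-occupied+ {1}                   _ _     _     = s≤s z≤n
≤-occupied+ {2}                   _ 2⇒1≤o _     = s≤s (2⇒1≤o ≤-refl)
≤-occupied+ {3}                   _ _     3⇒2≤o = s≤s (3⇒2≤o ≤-refl)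
≤-occupied+ {suc (suc (suc (suc _)))} (s≤s (s≤s (s≤s ()))) _ _

module Unsolvable {n} (G : Digraph n) (G? : ∀ i j → Dec (G i j)) (oriented : IsOriented G)
                  (diam : HasStrongDiam2 G) {C : Config n} {r : Fin n} (unsolvable : ¬ Solvable G C r) where

  private
    loopless : ∀ i → ¬ G i i
    loopless = proj₁ oriented

  open Solvability G loopless r
  open Strategies G loopless diam r

  root-empty : C r ≡ 0
  root-empty = n≤0⇒n≡0 (≮⇒≥ (unsolvable ∘ solvable-root))

  at-most-3 : ∀ v → C v ≤ 3
  at-most-3 v = ≮⇒≥ (unsolvable ∘ solvable-4)

  in-neighbour-at-most-1 : ∀ {x} → G x r → C x ≤ 1
  in-neighbour-at-most-1 Gxr = ≮⇒≥ (unsolvable ∘ solvable-2→r Gxr)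

  Heavy : Fin n → Set
  Heavy v = 2 ≤ C v

  heavy : ∀ {v} → 3 ≤ C v → Heavy v
  heavy = ≤-trans (n≤1+n 2)

  hub : Fin n → Fin n
  hub u with u ≟ r
  ... | yes _ = r
  ... | no u≢r with diam u r u≢r
  ...   | inj₁ _       = r
  ...   | inj₂ (k , _) = k

  hub-arcs : ∀ {u} → Heavy u → G u (hub u) × G (hub u) r
  hub-arcs {u} 2≤Cu with u ≟ r
  ... | yes refl = ⊥-elim (<⇒≱ 2≤Cu (≤-trans (≤-reflexive root-empty) z≤n))
  ... | no u≢r with diam u r u≢r
  ...   | inj₁ Gur             = ⊥-elim (<⇒≱ 2≤Cu (in-neighbour-at-most-1 Gur))
  ...   | inj₂ (k , Guk , Gkr) = Guk , Gkr

  hub-private : ∀ {s u} → Heavy s → Heavy u → s ≢ u → ¬ G s (hub u)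
  hub-private 2≤Cs 2≤Cu s≢u Gs-hub =
    unsolvable (solvable-2+2 Gs-hub (proj₁ (hub-arcs 2≤Cu)) s≢u (proj₂ (hub-arcs 2≤Cu)) 2≤Cs 2≤Cu)

  hub-empty : ∀ {u} → Heavy u → C (hub u) ≡ 0
  hub-empty 2≤Cu =
    n≤0⇒n≡0 (≮⇒≥ (unsolvable ∘ solvable-2→1 (proj₁ (hub-arcs 2≤Cu)) (proj₂ (hub-arcs 2≤Cu)) 2≤Cu))

  HeavyArc : Fin n → Fin n → Set
  HeavyArc w e = Heavy w × G w e

  HeavyArc? : ∀ w e → Dec (HeavyArc w e)
  HeavyArc? w e = (2 ≤? C w) ×-dec G? w e

  HasSpare : Fin n → Set
  HasSpare u = ∃ λ e → e ≢ hub u × C e ≡ 0 × G u e × (∀ w → HeavyArc w e → w ≡ u)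

  HasSpare? : ∀ u → Dec (HasSpare u)
  HasSpare? u = any? λ e →
    ¬? (e ≟ hub u) ×-dec C e ℕ.≟ 0 ×-dec G? u e ×-dec all? (λ w → HeavyArc? w e →-dec w ≟ u)

  Deficient : Fin n → Set
  Deficient u = 3 ≤ C u × ¬ HasSpare u

  exceptional : Fin n
  exceptional with any? (λ u → (3 ≤? C u) ×-dec ¬? (HasSpare? u))
  ... | yes (u , _) = u
  ... | no _        = r

  exceptional-deficient : ∀ {v} → Deficient v → Deficient exceptional
  exceptional-deficient {v} v-deficient with any? (λ u → (3 ≤? C u) ×-dec ¬? (HasSpare? u))
  ... | yes (_ , deficient) = deficient
  ... | no ∄deficient       = ⊥-elim (∄deficient (v , v-deficient))

  Owns : Fin n → Fin n → Set
  Owns v e = C e ≡ 0 × HeavyArc v e × (∀ w → HeavyArc w e → w ≡ v ⊎ (w ≡ exceptional × v ≢ exceptional))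

  Owns? : ∀ v e → Dec (Owns v e)
  Owns? v e = C e ℕ.≟ 0 ×-dec HeavyArc? v e ×-dec
    all? (λ w → HeavyArc? w e →-dec (w ≟ v ⊎-dec (w ≟ exceptional ×-dec ¬? (v ≟ exceptional))))

  Owns-unique : ∀ {v v′ e} → Owns v e → Owns v′ e → v ≡ v′
  Owns-unique {v} {v′} (_ , v→e , only-v) (_ , v′→e , only-v′) with only-v v′ v′→e | only-v′ v v→e
  ... | inj₁ v′≡v               | _                         = sym v′≡v
  ... | inj₂ _                  | inj₁ v≡v′                 = v≡v′
  ... | inj₂ (v′≡exc , v≢exc)   | inj₂ (v≡exc , _)          = ⊥-elim (v≢exc v≡exc)

  owns-hub : ∀ {v} → Heavy v → Owns v (hub v)
  owns-hub {v} 2≤Cv = hub-empty 2≤Cv , (2≤Cv , proj₁ (hub-arcs 2≤Cv)) , only-v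
    where
    only-v : ∀ w → HeavyArc w (hub v) → w ≡ v ⊎ (w ≡ exceptional × v ≢ exceptional)
    only-v w (2≤Cw , Gw-hub) with w ≟ v
    ... | yes w≡v = inj₁ w≡v
    ... | no w≢v  = ⊥-elim (hub-private 2≤Cw 2≤Cv w≢v Gw-hub)

  between-heavy : ∀ {x y k} → 3 ≤ C x → 3 ≤ C y → x ≢ y → G x k → G k (hub y) →
                  C k ≡ 0 × (∀ s → HeavyArc s k → s ≡ x ⊎ s ≡ y)
  between-heavy {x} {y} {k} 3≤Cx 3≤Cy x≢y Gxk Gk-hub = Ck≡0 , heavy-in⊆
    where
    Gy-hub : G y (hub y)
    Gy-hub = proj₁ (hub-arcs (heavy 3≤Cy))

    Ghub-r : G (hub y) r
    Ghub-r = proj₂ (hub-arcs (heavy 3≤Cy))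

    y≢k : y ≢ k
    y≢k refl = unsolvable (solvable-2→3 Gxk (heavy 3≤Cx) 3≤Cy)

    Ck≡0 : C k ≡ 0
    Ck≡0 = n≤0⇒n≡0 (≮⇒≥ λ 1≤Ck →
      unsolvable (solvable-2→1+2 Gxk Gk-hub Gy-hub Ghub-r (heavy 3≤Cx) 1≤Ck (heavy 3≤Cy) (≢-sym x≢y) y≢k))

    heavy-in⊆ : ∀ s → HeavyArc s k → s ≡ x ⊎ s ≡ y
    heavy-in⊆ s (2≤Cs , Gsk) with s ≟ x | s ≟ y
    ... | yes s≡x | _       = inj₁ s≡x
    ... | no _    | yes s≡y = inj₂ s≡y
    ... | no s≢x  | no s≢y  = ⊥-elim (unsolvable (solvable-2+2→0+2 Gsk Gxk Gk-hub Gy-hub Ghub-r s≢x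
                                 2≤Cs (heavy 3≤Cx) (heavy 3≤Cy) (≢-sym s≢y) (≢-sym x≢y) y≢k))

  Shared : Fin n → Fin n → Fin n → Set
  Shared x y k = C k ≡ 0 × HeavyArc x k × HeavyArc y k × (∀ s → HeavyArc s k → s ≡ x ⊎ s ≡ y)

  shared-or-hub-arc : ∀ {x y} → 3 ≤ C x → 3 ≤ C y → ¬ HasSpare x → x ≢ y →
                      ∃ (Shared x y) ⊎ G (hub x) (hub y)
  shared-or-hub-arc {x} {y} 3≤Cx 3≤Cy no-spare x≢y with diam x (hub y) x≢hub
    where
    x≢hub : x ≢ hub y
    x≢hub x≡hub = <⇒≱ 3≤Cx (≤-trans (≤-reflexive (trans (cong C x≡hub) (hub-empty (heavy 3≤Cy)))) z≤n)
  ... | inj₁ Gx-hub = ⊥-elim (hub-private (heavy 3≤Cx) (heavy 3≤Cy) x≢y Gx-hub)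
  ... | inj₂ (k , Gxk , Gk-hub) with between-heavy 3≤Cx 3≤Cy x≢y Gxk Gk-hub | G? y k
  ...   | Ck≡0 , heavy-in⊆ | yes Gyk =
    inj₁ (k , Ck≡0 , (heavy 3≤Cx , Gxk) , (heavy 3≤Cy , Gyk) , heavy-in⊆)
  ...   | Ck≡0 , heavy-in⊆ | no ¬Gyk = inj₂ (subst (λ z → G z (hub y)) k≡hub Gk-hub)
    where
    only-x : ∀ s → HeavyArc s k → s ≡ x
    only-x s s→k with heavy-in⊆ s s→k
    ... | inj₁ s≡x    = s≡x
    ... | inj₂ refl   = ⊥-elim (¬Gyk (proj₂ s→k))

    k≡hub : k ≡ hub x
    k≡hub with k ≟ hub x
    ... | yes k≡hub = k≡hub
    ... | no k≢hub  = ⊥-elim (no-spare (k , k≢hub , Ck≡0 , Gxk , only-x))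

  Shared-swap : ∀ {x y k} → Shared x y k → Shared y x k
  Shared-swap (Ck≡0 , x→k , y→k , heavy-in⊆) = Ck≡0 , y→k , x→k , λ s s→k → Sum.swap (heavy-in⊆ s s→k)

  owns-shared : ∀ {v k} → Heavy v → v ≢ exceptional → Shared v exceptional k → k ≢ hub v × Owns v k
  owns-shared 2≤Cv v≢exc (Ck≡0 , v→k , (2≤Cexc , Gexc-k) , heavy-in⊆) =
    (λ { refl → hub-private 2≤Cexc 2≤Cv (≢-sym v≢exc) Gexc-k }) ,
    Ck≡0 , v→k , λ w w→k → Sum.map₂ (_, v≢exc) (heavy-in⊆ w w→k)

  second-owned : ∀ {v} → 3 ≤ C v → ¬ HasSpare v → v ≢ exceptional → ∃ λ k → k ≢ hub v × Owns v k
  second-owned {v} 3≤Cv no-spare v≢exc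
    with shared-or-hub-arc 3≤Cv 3≤Cexc no-spare v≢exc
       | shared-or-hub-arc 3≤Cexc 3≤Cv no-spare-exc (≢-sym v≢exc)
    where
    3≤Cexc : 3 ≤ C exceptional
    3≤Cexc = proj₁ (exceptional-deficient (3≤Cv , no-spare))
    no-spare-exc : ¬ HasSpare exceptional
    no-spare-exc = proj₂ (exceptional-deficient (3≤Cv , no-spare))
  ... | inj₁ (k , shared) | _                 = k , owns-shared (heavy 3≤Cv) v≢exc shared
  ... | inj₂ _            | inj₁ (k , shared) = k , owns-shared (heavy 3≤Cv) v≢exc (Shared-swap shared)
  ... | inj₂ hub→hub      | inj₂ hub←hub      = ⊥-elim (proj₂ oriented _ _ hub→hub hub←hub)

  owned : Fin n → ℕ
  owned v = count (Owns? v)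

  owners : Fin n → ℕ
  owners e = count (λ v → Owns? v e)

  owned-≥1 : ∀ {v} → Heavy v → 1 ≤ owned v
  owned-≥1 {v} 2≤Cv = count-≥1 (Owns? v) (owns-hub 2≤Cv)

  owned-≥2 : ∀ {v} → 3 ≤ C v → v ≢ exceptional → 2 ≤ owned v
  owned-≥2 {v} 3≤Cv v≢exc with HasSpare? v
  ... | yes (e , e≢hub , Ce≡0 , Gve , only-v) =
    count-≥2 (Owns? v) e≢hub (Ce≡0 , (heavy 3≤Cv , Gve) , λ w w→e → inj₁ (only-v w w→e))
      (owns-hub (heavy 3≤Cv))
  ... | no no-spare with second-owned 3≤Cv no-spare v≢exc
  ...   | k , k≢hub , owns-k = count-≥2 (Owns? v) k≢hub owns-k (owns-hub (heavy 3≤Cv))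

  owned+exceptional-≥2 : ∀ {v} → 3 ≤ C v → 2 ≤ owned v + 𝟙 (v ≟ exceptional)
  owned+exceptional-≥2 {v} 3≤Cv = by-cases (v ≟ exceptional)
    where
    by-cases : (v≟exc : Dec (v ≡ exceptional)) → 2 ≤ owned v + 𝟙 v≟exc
    by-cases (yes _)     = +-monoˡ-≤ 1 (owned-≥1 (heavy 3≤Cv))
    by-cases (no v≢exc)  = ≤-trans (owned-≥2 3≤Cv v≢exc) (m≤m+n (owned v) 0)

  pebbles-≤ : ∀ v → C v ≤ 𝟙 (1 ≤? C v) + (owned v + 𝟙 (v ≟ exceptional))
  pebbles-≤ v = ≤-occupied+ (at-most-3 v) (λ 2≤Cv → ≤-trans (owned-≥1 2≤Cv) (m≤m+n _ _)) owned+exceptional-≥2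

  owners-root : owners r ≡ 0
  owners-root = count-none (λ v → Owns? v r)
    λ { v (_ , (2≤Cv , Gvr) , _) → <⇒≱ 2≤Cv (in-neighbour-at-most-1 Gvr) }

  owners-≤-vacant : ∀ e → owners e ≤ 𝟙 (C e ℕ.≟ 0)
  owners-≤-vacant e = by-cases (C e ℕ.≟ 0)
    where
    by-cases : (Ce≟0 : Dec (C e ≡ 0)) → owners e ≤ 𝟙 Ce≟0
    by-cases (yes _)    = count-≤1 (λ v → Owns? v e) (λ _ _ → Owns-unique)
    by-cases (no Ce≢0)  = ≤-reflexive (count-none (λ v → Owns? v e) (λ _ → Ce≢0 ∘ proj₁))

  owners+root-≤ : ∀ e → owners e + 𝟙 (e ≟ r) ≤ 𝟙 (C e ℕ.≟ 0)
  owners+root-≤ e = by-cases (e ≟ r)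
    where
    by-cases : (e≟r : Dec (e ≡ r)) → owners e + 𝟙 e≟r ≤ 𝟙 (C e ℕ.≟ 0)
    by-cases (yes refl) =
      ≤-trans (≤-reflexive (cong (_+ 1) owners-root)) (𝟙-mono (yes root-empty) (C r ℕ.≟ 0) id)
    by-cases (no _)     = ≤-trans (≤-reflexive (+-identityʳ (owners e))) (owners-≤-vacant e)

  size-≤ : size C ≤ n
  size-≤ = begin
    size C                                                    ≡⟨ size≡sum C ⟩
    sum C                                                     ≤⟨ sum-mono-≤ pebbles-≤ ⟩
    sum (λ v → occupied v + (owned v + 𝟙 (v ≟ exceptional)))  ≡⟨ split owned exceptional ⟩
    sum occupied + (sum owned + 1)                            ≡⟨ cong (λ t → sum occupied + (t + 1)) owned≡owners ⟩
    sum occupied + (sum owners + 1)                           ≡⟨ cong (sum occupied +_) split-root ⟨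
    sum occupied + sum (λ e → owners e + 𝟙 (e ≟ r))           ≤⟨ +-monoʳ-≤ (sum occupied) (sum-mono-≤ owners+root-≤) ⟩
    sum occupied + sum vacant                                 ≡⟨ ∑-distrib-+ occupied vacant ⟨
    sum (λ v → occupied v + vacant v)                         ≡⟨ sum-cong-≗ (λ v → occupied+vacant (C v)) ⟩
    sum {n} (λ _ → 1)                                         ≡⟨ sum-ones n ⟩
    n                                                         ∎
    where
    open ≤-Reasoning
    occupied vacant : Fin n → ℕ
    occupied v = 𝟙 (1 ≤? C v)
    vacant v = 𝟙 (C v ℕ.≟ 0)

    split : ∀ (f : Fin n → ℕ) a → sum (λ v → occupied v + (f v + 𝟙 (v ≟ a))) ≡ sum occupied + (sum f + 1)
    split f a = trans (∑-distrib-+ occupied _)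
      (cong (sum occupied +_) (trans (∑-distrib-+ f _) (cong (sum f +_) (count-≡ a))))

    split-root : sum (λ e → owners e + 𝟙 (e ≟ r)) ≡ sum owners + 1
    split-root = trans (∑-distrib-+ owners _) (cong (sum owners +_) (count-≡ r))

    owned≡owners : sum owned ≡ sum owners
    owned≡owners = ∑-comm (λ v e → 𝟙 (Owns? v e))

solvable-if-size>n : ∀ {n} {D : Digraph n} → IsOriented D → HasStrongDiam2 D →
                     ∀ C r → n < size C → Solvable D C r
solvable-if-size>n {n} {D} oriented diam C r n<size =
  Solvable-mono Skel⊆A (decidable-stable (solvable? Skel? C) λ unsolvable →
    <⇒≱ n<size (Unsolvable.size-≤ Skel Skel? (Skel-oriented oriented) Skel-diam unsolvable))
  where
  open Skeleton D diam
  open Solvability Skel (proj₁ (Skel-oriented oriented)) r using (solvable?)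

theorem2 : (n : ℕ) (D : Digraph n) → IsOriented D → HasStrongDiam2 D →
    PebblingNumber≤ D (suc n)
theorem2 n D oriented diam =
  suc n , ≤-refl , λ C size≡1+n r → solvable-if-size>n oriented diam C r (≤-reflexive (sym size≡1+n))
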